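{- Every tree $T$ with at least one edge admits an odd-edge felicitous-difference total coloring.
   Context: For a tree $T$ with $q\ge1$ edges, $[0,2q-1]=\{0,1,\dots,2q-1\}$ and $[1,2q-1]^o$ is the set of odd integers in $[1,2q-1]$. An odd-edge felicitous-difference total coloring of $T$ is a map $h:V(T)\cup E(T)\to[0,2q-1]$ (vertex colors need not be distinct) such that $\{h(e):e\in E(T)\}=[1,2q-1]^o$ and there is a non-negative integer $k$ with $|h(u)+h(v)-h(uv)|=k$ for every edge $uv\in E(T)$. -}

module Defs where

open import Data.Nat using (ℕ; zero; suc; _+_; _*_; _<_; _≤_; ∣_-_∣)
open import Data.Fin using (Fin)
open import Data.Product using (Σ; ∃; ∃-syntax; _×_; _,_; proj₁; proj₂)
open import Data.Sum using (_⊎_)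
open import Relation.Nullary using (¬_)
open import Data.List using (List; []; _∷_)
open import Data.List.Relation.Unary.Unique.Propositional using (Unique)
open import Relation.Binary.PropositionalEquality using (_≡_; _≢_)

record Graph : Set where
  field
    n    : ℕ
    q    : ℕ
    ends : Fin q → Fin n × Fin n

open Graph public

SamePair : {n : ℕ} → Fin n × Fin n → Fin n × Fin n → Set
SamePair (u , v) (x , y) = (u ≡ x × v ≡ y) ⊎ (u ≡ y × v ≡ x)

Simple : Graph → Set
Simple G = (∀ e → proj₁ (ends G e) ≢ proj₂ (ends G e))
         × (∀ e f → SamePair (ends G e) (ends G f) → e ≡ f)

Adj : (G : Graph) → Fin (n G) → Fin (n G) → Set
Adj G u v = ∃[ e ] SamePair (ends G e) (u , v)

data Walk (G : Graph) : Fin (n G) → Fin (n G) → Set where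
  here : ∀ {u} → Walk G u u
  step : ∀ {u w v} → Adj G u w → Walk G w v → Walk G u v

Connected : Graph → Set
Connected G = ∀ u v → Walk G u v

PathFrom : (G : Graph) → Fin (n G) → List (Fin (n G)) → Fin (n G) → Set
PathFrom G x []       z = Adj G x z
PathFrom G x (y ∷ ys) z = Adj G x y × PathFrom G y ys z

-- a cycle: distinct vertices v₀ v₁ v₂ … v_k (k ≥ 2), consecutive adjacent,
-- and v_k adjacent to v₀
Cycle : Graph → Set
Cycle G = Σ (Fin (n G)) λ v₀ → Σ (Fin (n G)) λ v₁ → Σ (List (Fin (n G))) λ rest →
          Σ (Fin (n G)) λ v₂ →
          Unique (v₀ ∷ v₁ ∷ v₂ ∷ rest) × Adj G v₀ v₁ × PathFrom G v₁ (v₂ ∷ rest) v₀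

Acyclic : Graph → Set
Acyclic G = ¬ Cycle G

Tree : Graph → Set
Tree T = Simple T × Connected T × Acyclic T

data Odd : ℕ → Set where
  odd : ∀ k → Odd (suc (2 * k))

OEFDTC : (T : Graph) → (Fin (n T) → ℕ) → (Fin (q T) → ℕ) → Set
OEFDTC T hV hE =
    (∀ v → hV v < 2 * q T)
  × (∀ e → hE e < 2 * q T)
  × (∀ e → Odd (hE e))
  × (∀ m → Odd m → m < 2 * q T → ∃[ e ] hE e ≡ m)
  × (∃[ k ] ∀ e → ∣ hV (proj₁ (ends T e)) + hV (proj₂ (ends T e)) - hE e ∣ ≡ k)

HasOEFDTC : Graph → Set
HasOEFDTC T = Σ (Fin (n T) → ℕ) λ hV → Σ (Fin (q T) → ℕ) λ hE → OEFDTC T hV hE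

-- Label only the vertices and give every edge the sum of its end labels (so k = 0).
-- Such labellings of forests are built by induction on the number of edges: a forest
-- with an edge has a pendant edge e, since otherwise one could walk forever without
-- turning back, and the first repeated vertex of such a walk closes a cycle. Label
-- the forest without e, give e the new largest odd label 2k+1 and its leaf 2k+1
-- minus the label of the other end.
module Submission where

open import Defs
open import Data.Bool using (Bool; true; false; not)
open import Data.Empty using (⊥; ⊥-elim)
open import Data.Fin as Fin using (Fin; punchIn; punchOut; toℕ)
open import Data.Fin.Properties
  using (punchInᵢ≢i; punchIn-injective; punchIn-punchOut; any?; all?; ¬∀⟶∃¬; pigeonhole; toℕ<n)
open import Data.List using ([]; _∷_; take; applyDownFrom)
open import Data.List.Membership.Propositional using (_∈_)
open import Data.List.Membership.Propositional.Properties using (∈-applyDownFrom⁺)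
open import Data.List.Relation.Unary.All as All using ()
open import Data.List.Relation.Unary.All.Properties using (¬Any⇒All¬)
open import Data.List.Relation.Unary.AllPairs using ([]; _∷_)
open import Data.List.Relation.Unary.Any using (here; there)
open import Data.List.Relation.Unary.Linked using (Linked; []; [-]; _∷_)
open import Data.List.Relation.Unary.Unique.Propositional using (Unique)
open import Data.List.Relation.Unary.Unique.Propositional.Properties using (take⁺)
open import Data.Nat using (ℕ; zero; suc; _+_; _*_; _∸_; _<_; _≤_; _≥_; z≤n)
open import Data.Nat.Properties
open import Data.Product using (∃; ∃-syntax; _×_; _,_; proj₁; proj₂)
open import Data.Sum using (_⊎_; inj₁; inj₂)
open import Data.Vec.Functional using (updateAt)
open import Data.Vec.Functional.Properties using (updateAt-updates; updateAt-minimal)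
open import Function using (_∘_; const)
open import Relation.Binary.PropositionalEquality using (_≡_; _≢_; refl; sym; trans; cong₂; subst; module ≡-Reasoning)
open import Relation.Nullary using (¬_; Dec; yes; no; contradiction)
open import Relation.Nullary.Decidable using (¬?; _→-dec_; _⊎-dec_; decidable-stable)

endpoint : (G : Graph) → Bool → Fin (q G) → Fin (n G)
endpoint G true  e = proj₁ (ends G e)
endpoint G false e = proj₂ (ends G e)

Touches : (G : Graph) → Fin (q G) → Fin (n G) → Set
Touches G f x = ∃[ c ] endpoint G c f ≡ x

touches? : (G : Graph) (f : Fin (q G)) (x : Fin (n G)) → Dec (Touches G f x)
touches? G f x with endpoint G true f Fin.≟ x | endpoint G false f Fin.≟ x
... | yes eq | _      = yes (true , eq)
... | no _   | yes eq = yes (false , eq)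
... | no ¬p  | no ¬q  = no λ { (true , eq) → ¬p eq ; (false , eq) → ¬q eq }

endpoint-Adj : ∀ {G} b e → Adj G (endpoint G b e) (endpoint G (not b) e)
endpoint-Adj true  e = e , inj₁ (refl , refl)
endpoint-Adj false e = e , inj₂ (refl , refl)

Adj-sym : ∀ {G u v} → Adj G u v → Adj G v u
Adj-sym (e , inj₁ eqs) = e , inj₂ eqs
Adj-sym (e , inj₂ eqs) = e , inj₁ eqs

Adj⇒Touches : ∀ {G u v} → Adj G u v → ∃[ e ] Touches G e u
Adj⇒Touches (e , inj₁ (u≡ , _)) = e , true , u≡
Adj⇒Touches (e , inj₂ (_ , u≡)) = e , false , u≡

module _ {G : Graph} (simple : Simple G) where

  endpoint≢ : ∀ b e → endpoint G b e ≢ endpoint G (not b) e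
  endpoint≢ true  e eq = proj₁ simple e eq
  endpoint≢ false e eq = proj₁ simple e (sym eq)

  reversed⇒≡ : ∀ b c {e f} → endpoint G c f ≡ endpoint G (not b) e →
               endpoint G (not c) f ≡ endpoint G b e → f ≡ e
  reversed⇒≡ true  true  p q = proj₂ simple _ _ (inj₂ (p , q))
  reversed⇒≡ true  false p q = proj₂ simple _ _ (inj₁ (q , p))
  reversed⇒≡ false true  p q = proj₂ simple _ _ (inj₁ (p , q))
  reversed⇒≡ false false p q = proj₂ simple _ _ (inj₂ (q , p))

record NonBacktrackingWalk (G : Graph) : Set where
  field
    vertex    : ℕ → Fin (n G)
    adjacent  : ∀ i → Adj G (vertex i) (vertex (suc i))
    no-loop   : ∀ i → vertex (suc i) ≢ vertex i
    no-return : ∀ i → vertex (suc (suc i)) ≢ vertex i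

module _ {G : Graph} where

  Linked⇒PathFrom : ∀ {x z w a} zs → Adj G x z → Linked (Adj G) (z ∷ zs) → w ∈ z ∷ zs →
                    Adj G w a → ∃[ k ] PathFrom G x (z ∷ take k zs) a
  Linked⇒PathFrom zs        x~z _           (here refl)  w~a = 0 , x~z , w~a
  Linked⇒PathFrom (z′ ∷ zs) x~z (z~z′ ∷ zs~) (there w∈zs) w~a
    with k , path ← Linked⇒PathFrom zs z~z′ zs~ w∈zs w~a = suc k , x~z , path

  chord⇒Cycle : ∀ {a b w} zs → Linked (Adj G) (a ∷ b ∷ zs) → Unique (a ∷ b ∷ zs) →
                w ∈ zs → Adj G w a → Cycle G
  chord⇒Cycle {a} {b} (c ∷ zs) (a~b ∷ b~c ∷ zs~) distinct w∈ w~a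
    with k , path ← Linked⇒PathFrom zs b~c zs~ w∈ w~a =
      a , b , take k zs , c , take⁺ (3 + k) distinct , a~b , path

module _ {G : Graph} (acyclic : Acyclic G) (walk : NonBacktrackingWalk G) where
  open NonBacktrackingWalk walk

  trace-Linked : ∀ j → Linked (Adj G) (applyDownFrom vertex j)
  trace-Linked zero          = []
  trace-Linked (suc zero)    = [-]
  trace-Linked (suc (suc j)) = Adj-sym (adjacent j) ∷ trace-Linked (suc j)

  trace-Unique : ∀ j → Unique (applyDownFrom vertex j)
  ¬revisit     : ∀ j → ¬ vertex j ∈ applyDownFrom vertex j

  trace-Unique zero    = []
  trace-Unique (suc j) = ¬Any⇒All¬ _ (¬revisit j) ∷ trace-Unique j

  ¬revisit (suc j)             (here eq)         = no-loop j eq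
  ¬revisit (suc (suc j))       (there (here eq)) = no-return j eq
  ¬revisit (suc (suc (suc j))) (there (there p)) =
    acyclic (chord⇒Cycle _ (trace-Linked (suc (suc (suc j)))) (trace-Unique (suc (suc (suc j)))) p
      (Adj-sym (adjacent (suc (suc j)))))

  trace-injective : ∀ m {i j} → Unique (applyDownFrom vertex m) → i < j → j < m → vertex j ≢ vertex i
  trace-injective (suc m) (fresh ∷ distinct) i<j j<1+m with m<1+n⇒m<n∨m≡n j<1+m
  ... | inj₁ j<m  = trace-injective m distinct i<j j<m
  ... | inj₂ refl = All.lookup fresh (∈-applyDownFrom⁺ vertex i<j)

  acyclic⇒¬NonBacktrackingWalk : ⊥
  acyclic⇒¬NonBacktrackingWalk with i , j , i<j , vi≡vj ← pigeonhole (n<1+n (n G)) (vertex ∘ toℕ) =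
    trace-injective (suc (n G)) (trace-Unique (suc (n G))) i<j (toℕ<n j) (sym vi≡vj)

Pendant : (G : Graph) → Fin (q G) → Bool → Set
Pendant G e b = ∀ f → f ≢ e → ¬ Touches G f (endpoint G b e)

avoids? : ∀ G e b f → Dec (f ≢ e → ¬ Touches G f (endpoint G b e))
avoids? G e b f = ¬? (f Fin.≟ e) →-dec ¬? (touches? G f (endpoint G b e))

pendant? : (G : Graph) (e : Fin (q G)) (b : Bool) → Dec (Pendant G e b)
pendant? G e b = all? (avoids? G e b)

record Branch (G : Graph) (e : Fin (q G)) (b : Bool) : Set where
  field
    edge   : Fin (q G)
    edge≢e : edge ≢ e
    side   : Bool
    meets  : endpoint G side edge ≡ endpoint G b e

¬Pendant⇒Branch : ∀ G e b → ¬ Pendant G e b → Branch G e b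
¬Pendant⇒Branch G e b ¬pendant
  with f , ¬p ← ¬∀⟶∃¬ (q G) _ (avoids? G e b) ¬pendant
  with c , meets ← decidable-stable (touches? G f (endpoint G b e)) (λ ¬t → ¬p (const ¬t)) =
    record { edge = f ; edge≢e = λ f≡e → ¬p (λ f≢e → contradiction f≡e f≢e) ; side = c ; meets = meets }

-- Arc i runs along edge i from its endpoint on side i (the tail) to the other end,
-- where the branch continuing it starts arc i + 1.
branchingWalk : ∀ {G} → Simple G → (∀ e b → Branch G e b) → Fin (q G) → NonBacktrackingWalk G
branchingWalk {G} simple branch e₀ = record
  { vertex    = tail
  ; adjacent  = λ i → subst (Adj G (tail i)) (sym (next-meets i)) (endpoint-Adj (side i) (edge i))
  ; no-loop   = λ i eq → endpoint≢ simple (side i) (edge i) (sym (trans (sym (next-meets i)) eq))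
  ; no-return = λ i eq → Branch.edge≢e (continue i)
      (reversed⇒≡ simple (side i) (side (suc i)) (next-meets i) (trans (sym (next-meets (suc i))) eq))
  }
  where
  arc : ℕ → Fin (q G) × Bool
  continue : ∀ i → Branch G (proj₁ (arc i)) (not (proj₂ (arc i)))

  arc zero    = e₀ , true
  arc (suc i) = Branch.edge (continue i) , Branch.side (continue i)
  continue i  = branch (proj₁ (arc i)) (not (proj₂ (arc i)))

  edge : ℕ → Fin (q G)
  edge i = proj₁ (arc i)

  side : ℕ → Bool
  side i = proj₂ (arc i)

  tail : ℕ → Fin (n G)
  tail i = endpoint G (side i) (edge i)

  next-meets : ∀ i → tail (suc i) ≡ endpoint G (not (side i)) (edge i)
  next-meets i = Branch.meets (continue i)

pendantEdge : ∀ {G} → Simple G → Acyclic G → Fin (q G) → ∃[ e ] ∃[ b ] Pendant G e b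
pendantEdge {G} simple acyclic e₀
  with any? (λ e → pendant? G e true ⊎-dec pendant? G e false)
... | yes (e , inj₁ pendant) = e , true , pendant
... | yes (e , inj₂ pendant) = e , false , pendant
... | no none = ⊥-elim (acyclic⇒¬NonBacktrackingWalk acyclic (branchingWalk simple branch e₀))
  where
  branch : ∀ e b → Branch G e b
  branch e true  = ¬Pendant⇒Branch G e true  (λ p → none (e , inj₁ p))
  branch e false = ¬Pendant⇒Branch G e false (λ p → none (e , inj₂ p))

graph : ∀ {m} k → (Fin k → Fin m × Fin m) → Graph
graph {m} k es = record { n = m ; q = k ; ends = es }

deleteEdge : ∀ {m k} → (Fin (suc k) → Fin m × Fin m) → Fin (suc k) → Graph
deleteEdge {k = k} es e = graph k (es ∘ punchIn e)

module _ {m k} (es : Fin (suc k) → Fin m × Fin m) (e : Fin (suc k)) where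

  deleteEdge-Simple : Simple (graph (suc k) es) → Simple (deleteEdge es e)
  deleteEdge-Simple (loopless , noMulti) =
    loopless ∘ punchIn e , λ f g same → punchIn-injective e f g (noMulti _ _ same)

  deleteEdge-Acyclic : Acyclic (graph (suc k) es) → Acyclic (deleteEdge es e)
  deleteEdge-Acyclic acyclic (v₀ , v₁ , rest , v₂ , distinct , v₀~v₁ , path) =
    acyclic (v₀ , v₁ , rest , v₂ , distinct , lift v₀~v₁ , liftPath (v₂ ∷ rest) path)
    where
    lift : ∀ {x y} → Adj (deleteEdge es e) x y → Adj (graph (suc k) es) x y
    lift (f , same) = punchIn e f , same

    liftPath : ∀ {x z} ys → PathFrom (deleteEdge es e) x ys z → PathFrom (graph (suc k) es) x ys z
    liftPath []       x~z          = lift x~z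
    liftPath (y ∷ ys) (x~y , path) = lift x~y , liftPath ys path

  punchIn-cases : ∀ f → f ≡ e ⊎ ∃[ f′ ] punchIn e f′ ≡ f
  punchIn-cases f with f Fin.≟ e
  ... | yes f≡e = inj₁ f≡e
  ... | no f≢e  = inj₂ (punchOut (f≢e ∘ sym) , punchIn-punchOut (f≢e ∘ sym))

edgeSum : (G : Graph) → (Fin (n G) → ℕ) → Fin (q G) → ℕ
edgeSum G h e = h (proj₁ (ends G e)) + h (proj₂ (ends G e))

edgeSum-endpoint : ∀ G h b e → edgeSum G h e ≡ h (endpoint G b e) + h (endpoint G (not b) e)
edgeSum-endpoint G h true  e = refl
edgeSum-endpoint G h false e = +-comm (h (proj₁ (ends G e))) (h (proj₂ (ends G e)))

Touches⇒≤edgeSum : ∀ G h {e x} → Touches G e x → h x ≤ edgeSum G h e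
Touches⇒≤edgeSum G h (true  , refl) = m≤m+n _ _
Touches⇒≤edgeSum G h (false , refl) = m≤n+m _ _

record OddEdgeSumLabelling (G : Graph) (h : Fin (n G) → ℕ) : Set where
  field
    -- keeps the truncated subtraction of the extension step exact
    vertex-≤     : ∀ v → h v ≤ 2 * q G
    edgeSum-<    : ∀ e → edgeSum G h e < 2 * q G
    edgeSum-odd  : ∀ e → Odd (edgeSum G h e)
    edgeSum-onto : ∀ m → Odd m → m < 2 * q G → ∃[ e ] edgeSum G h e ≡ m

Odd⇒≢even : ∀ {m} → Odd m → ∀ k → m ≢ 2 * k
Odd⇒≢even (odd j) k eq = even≢odd k j (sym eq)

Odd-<2[1+k]⇒<2k : ∀ {m k} → Odd m → m < 2 * suc k → m ≢ suc (2 * k) → m < 2 * k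
Odd-<2[1+k]⇒<2k {m} {k} odd-m m<2[1+k] m≢top =
  ≤∧≢⇒< (m<1+n⇒m≤n (≤∧≢⇒< (m<1+n⇒m≤n m<2+2k) m≢top)) (Odd⇒≢even odd-m k)
  where
  m<2+2k : m < 2 + 2 * k
  m<2+2k = subst (m <_) (*-suc 2 k) m<2[1+k]

module PendantExtension {m k} (es : Fin (suc k) → Fin m × Fin m) (simple : Simple (graph (suc k) es))
  (e : Fin (suc k)) (b : Bool) (pendant : Pendant (graph (suc k) es) e b)
  {h : Fin m → ℕ} (labelling : OddEdgeSumLabelling (deleteEdge es e) h) where

  open OddEdgeSumLabelling labelling

  G : Graph
  G = graph (suc k) es

  leaf stem : Fin m
  leaf = endpoint G b e
  stem = endpoint G (not b) e

  top : ℕ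
  top = suc (2 * k)

  top<2[1+k] : top < 2 * suc k
  top<2[1+k] = ≤-reflexive (sym (*-suc 2 k))

  2k≤2[1+k] : 2 * k ≤ 2 * suc k
  2k≤2[1+k] = *-monoʳ-≤ 2 (n≤1+n k)

  h⁺ : Fin m → ℕ
  h⁺ = updateAt h leaf (const (top ∸ h stem))

  h⁺-off-leaf : ∀ {v} → v ≢ leaf → h⁺ v ≡ h v
  h⁺-off-leaf {v} v≢leaf = updateAt-minimal v leaf h v≢leaf

  edgeSum-e : edgeSum G h⁺ e ≡ top
  edgeSum-e = begin
    edgeSum G h⁺ e                ≡⟨ edgeSum-endpoint G h⁺ b e ⟩
    h⁺ leaf + h⁺ stem             ≡⟨ cong₂ _+_ (updateAt-updates leaf h) (h⁺-off-leaf (endpoint≢ simple b e ∘ sym)) ⟩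
    (top ∸ h stem) + h stem       ≡⟨ m∸n+n≡m (≤-trans (vertex-≤ stem) (n≤1+n _)) ⟩
    top                           ∎
    where open ≡-Reasoning

  edgeSum-punchIn : ∀ f → edgeSum G h⁺ (punchIn e f) ≡ edgeSum (deleteEdge es e) h f
  edgeSum-punchIn f = cong₂ _+_ (h⁺-off-leaf (avoids true)) (h⁺-off-leaf (avoids false))
    where
    avoids : ∀ c → endpoint G c (punchIn e f) ≢ leaf
    avoids c eq = pendant (punchIn e f) (punchInᵢ≢i e f) (c , eq)

  extended : OddEdgeSumLabelling G h⁺
  extended = record
    { vertex-≤     = vertex-≤⁺
    ; edgeSum-<    = edgeSum-<⁺
    ; edgeSum-odd  = edgeSum-odd⁺
    ; edgeSum-onto = edgeSum-onto⁺
    }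
    where
    vertex-≤⁺ : ∀ v → h⁺ v ≤ 2 * suc k
    vertex-≤⁺ v with v Fin.≟ leaf
    ... | yes refl = subst (_≤ 2 * suc k) (sym (updateAt-updates leaf h))
                       (≤-trans (m∸n≤m top (h stem)) (<⇒≤ top<2[1+k]))
    ... | no v≢leaf = subst (_≤ 2 * suc k) (sym (h⁺-off-leaf v≢leaf)) (≤-trans (vertex-≤ v) 2k≤2[1+k])

    edgeSum-<⁺ : ∀ f → edgeSum G h⁺ f < 2 * suc k
    edgeSum-<⁺ f with punchIn-cases es e f
    ... | inj₁ refl = subst (_< 2 * suc k) (sym edgeSum-e) top<2[1+k]
    ... | inj₂ (f′ , refl) = subst (_< 2 * suc k) (sym (edgeSum-punchIn f′)) (<-≤-trans (edgeSum-< f′) 2k≤2[1+k])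

    edgeSum-odd⁺ : ∀ f → Odd (edgeSum G h⁺ f)
    edgeSum-odd⁺ f with punchIn-cases es e f
    ... | inj₁ refl = subst Odd (sym edgeSum-e) (odd k)
    ... | inj₂ (f′ , refl) = subst Odd (sym (edgeSum-punchIn f′)) (edgeSum-odd f′)

    edgeSum-onto⁺ : ∀ j → Odd j → j < 2 * suc k → ∃[ f ] edgeSum G h⁺ f ≡ j
    edgeSum-onto⁺ j odd-j j< with j ≟ top
    ... | yes refl = e , edgeSum-e
    ... | no j≢top with f′ , sum≡j ← edgeSum-onto j odd-j (Odd-<2[1+k]⇒<2k odd-j j< j≢top) =
      punchIn e f′ , trans (edgeSum-punchIn f′) sum≡j

forest-labelling : ∀ {m} k (es : Fin k → Fin m × Fin m) →
                   Simple (graph k es) → Acyclic (graph k es) → ∃ (OddEdgeSumLabelling (graph k es))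
forest-labelling zero    es _ _ = const 0 , record
  { vertex-≤ = λ _ → z≤n ; edgeSum-< = λ () ; edgeSum-odd = λ () ; edgeSum-onto = λ _ _ () }
forest-labelling (suc k) es simple acyclic
  with e , b , pendant ← pendantEdge simple acyclic Fin.zero
  with h , labelling ← forest-labelling k (es ∘ punchIn e)
                         (deleteEdge-Simple es e simple) (deleteEdge-Acyclic es e acyclic) =
    _ , PendantExtension.extended es simple e b pendant labelling

Connected⇒Touches : ∀ {G} → Connected G → Fin (q G) → ∀ v → ∃[ e ] Touches G e v
Connected⇒Touches {G} connected e₀ v with connected v (endpoint G true e₀)
... | here       = e₀ , true , refl
... | step v~w _ = Adj⇒Touches v~w

mainTheorem11 : (T : Graph) → Tree T → q T ≥ 1 → HasOEFDTC T
mainTheorem11 T (simple , connected , acyclic) q≥1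
  with h , labelling ← forest-labelling (q T) (ends T) simple acyclic =
    h , edgeSum T h , vertex-< , edgeSum-< , edgeSum-odd , edgeSum-onto , 0 , λ e → ∣n-n∣≡0 (edgeSum T h e)
  where
  open OddEdgeSumLabelling labelling

  vertex-< : ∀ v → h v < 2 * q T
  vertex-< v with e , touches ← Connected⇒Touches connected (Fin.fromℕ< q≥1) v =
    ≤-<-trans (Touches⇒≤edgeSum T h touches) (edgeSum-< e)
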